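{- Let $r\ge 2$ and $t\ge 2$ be integers, and let $c$ be the minimum size of an $(r-1)$-$(r+t-1,r,1)$ covering. If $n=a(r+t-1)+b$ with nonnegative integers $a,b$ and $b\le r+t-2$, then $$a\left(\binom{r+t-1}{r}-c\right)+\binom{b}{r}\le ex_r\bigl(n,Tr(K_{1,t})\bigr).$$
   Context: For a graph $F$ with vertex set $\{v_1,\ldots,v_p\}$ and edge set $\{e_1,\ldots,e_q\}$, a hypergraph $\mathcal{H}$ contains $F$ as a trace if there exist distinct vertices $w_1,\ldots,w_p\in V(\mathcal{H})$ and distinct edges $f_1,\ldots,f_q\in E(\mathcal{H})$ such that whenever $e_i=v_\alpha v_\beta$ we have $f_i\cap\{w_1,\ldots,w_p\}=\{w_\alpha,w_\beta\}$. For $r\ge 2$, $ex_r(n,Tr(F))$ denotes the maximum number of edges of an $n$-vertex $r$-uniform hypergraph that does not contain $F$ as a trace. $K_{1,t}$ is the star with $t$ leaves. For $v\ge k\ge s$, an $s$-$(v,k,\lambda)$ covering is a collection $\mathcal{C}$ of $k$-subsets (blocks) of a $v$-element set $X$ such that every $s$-subset of $X$ is contained in at least $\lambda$ blocks of $\mathcal{C}$; its size is $|\mathcal{C}|$. Here $\binom{b}{r}=0$ if $b<r$. -}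

module Defs where

open import Data.Nat using (ℕ; zero; suc; _≤_)
open import Data.Fin using (Fin; zero; suc)
open import Data.Fin.Subset using (Subset; _∈_; _⊆_; ∣_∣)
open import Data.Fin.Subset.Properties using (_⊆?_)
open import Data.List using (List; length; lookup; filter)
open import Data.List.Relation.Unary.All using (All)
open import Data.List.Relation.Unary.Unique.Propositional using (Unique)
open import Data.Product using (Σ; _×_)
open import Data.Sum using (_⊎_)
open import Function.Definitions using (Injective)
open import Relation.Binary.PropositionalEquality using (_≡_)
open import Relation.Nullary using (¬_)
open import Function.Bundles using (_⇔_)

record UniformHypergraph (r n : ℕ) : Set where
  field
    edges    : List (Subset n)
    distinct : Unique edges
    uniform  : All (λ e → ∣ e ∣ ≡ r) edges

open UniformHypergraph public

numEdges : ∀ {r n} → UniformHypergraph r n → ℕ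
numEdges H = length (edges H)

-- Star vertices: zero is the centre,
-- suc i is the i-th leaf; star edge i joins zero and suc i.
-- w : distinct host vertices, f : distinct host edges (as indices into the edge list),
-- and f_i ∩ {w_0,…,w_t} = {w_0, w_{i+1}}.
ContainsStarTrace : ∀ {r n} → (t : ℕ) → UniformHypergraph r n → Set
ContainsStarTrace {r} {n} t H =
  Σ (Fin (suc t) → Fin n) λ w →
  Σ (Fin t → Fin (length (edges H))) λ f →
    Injective _≡_ _≡_ w × Injective _≡_ _≡_ f ×
    (∀ (i : Fin t) (j : Fin (suc t)) →
       (w j ∈ lookup (edges H) (f i)) ⇔ ((j ≡ zero) ⊎ (j ≡ suc i)))

coverCount : ∀ {v} → Subset v → List (Subset v) → ℕ
coverCount S C = length (filter (S ⊆?_) C)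

IsCovering : (s v k λ′ : ℕ) → List (Subset v) → Set
IsCovering s v k λ′ C =
  All (λ B → ∣ B ∣ ≡ k) C × (∀ (S : Subset v) → ∣ S ∣ ≡ s → λ′ ≤ coverCount S C)

IsMinCoveringSize : (s v k λ′ c : ℕ) → Set
IsMinCoveringSize s v k λ′ c =
  Σ (List (Subset v)) (λ C → IsCovering s v k λ′ C × length C ≡ c) ×
  (∀ C → IsCovering s v k λ′ C → c ≤ length C)

{-# OPTIONS --safe #-}
-- The extremal hypergraph is the disjoint union of a copies of the r-graph on r + t − 1
-- vertices whose edges are the r-sets that are not blocks of a minimum (r−1)-(r+t−1, r, 1)
-- covering, and of the complete r-graph on b vertices. All edges of a K_{1,t} trace pass
-- through its centre, so a trace in the union lies in one component. A trace edge meets the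
-- t + 1 trace vertices in exactly two, so a trace needs at least r + t − 1 vertices; this
-- rules out the complete component. In a covering component the complement S of the t
-- leaves is an (r−1)-set, so some block K ⊇ S also contains a leaf; the trace edge through
-- that leaf lies in S plus the leaf, hence equals K, which is not an edge.
module Submission where

open import Defs
open import Data.Bool using () renaming (_≟_ to _≟ᵇ_)
open import Data.Empty using (⊥-elim)
open import Data.Fin using (Fin; zero; suc; _↑ˡ_; _↑ʳ_; splitAt)
open import Data.Fin.Properties
  using (suc-injective; ↑ˡ-injective; ↑ʳ-injective; splitAt⁻¹-↑ˡ; splitAt⁻¹-↑ʳ; injective⇒≤)
open import Data.Fin.Subset
open import Data.Fin.Subset.Properties
open import Data.List using (List; []; _∷_; map; _++_; length; lookup; filter)
open import Data.List.Properties using (length-map; length-++)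
open import Data.List.Membership.Propositional using () renaming (_∈_ to _∈ₗ_; _∉_ to _∉ₗ_)
open import Data.List.Membership.Propositional.Properties using (∈-lookup; ∈-map⁻; ∈-++⁻; ∈-filter⁻)
open import Data.List.Relation.Binary.Subset.Propositional using () renaming (_⊆_ to _⊆ₗ_)
open import Data.List.Relation.Unary.All as All using (All; []; _∷_)
import Data.List.Relation.Unary.All.Properties as All
import Data.List.Relation.Unary.Any as Any
open import Data.List.Relation.Unary.Any.Properties using (lookup-index)
open import Data.List.Relation.Unary.AllPairs using ([]; _∷_)
open import Data.List.Relation.Unary.Unique.Propositional using (Unique)
import Data.List.Relation.Unary.Unique.Propositional.Properties as Unique
open import Data.Nat using (ℕ; zero; suc; _+_; _*_; _∸_; _≤_; _<_; z≤n; s≤s)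
open import Data.Nat.Combinatorics using (_C_; nCk+nC[k+1]≡[n+1]C[k+1])
open import Data.Nat.Properties hiding (suc-injective)
open import Data.Product using (Σ; ∃; _×_; _,_; proj₁; proj₂)
open import Data.Sum using (_⊎_; inj₁; inj₂)
open import Data.Vec using ([]; _∷_; here; there) renaming (_++_ to _++ᵛ_)
open import Data.Vec.Properties using (≡-dec; ∷-injectiveʳ; ++-injectiveˡ; ++-injectiveʳ)
open import Function using (_∘_)
open import Function.Bundles using (_⇔_; mk⇔; Equivalence)
open import Function.Definitions using (Injective)
import Function.Properties.Equivalence as ⇔
open import Level using (0ℓ)
open import Relation.Binary.PropositionalEquality
open import Relation.Nullary using (¬_; Dec; yes; no; contradiction)
open import Relation.Unary using (Pred; Decidable)
open import Relation.Unary.Properties using (∁?)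

private
  variable
    m n r t : ℕ

x∉p⇒∣⁅x⁆∪p∣≡1+∣p∣ : ∀ (x : Fin n) p → x ∉ p → ∣ ⁅ x ⁆ ∪ p ∣ ≡ suc ∣ p ∣
x∉p⇒∣⁅x⁆∪p∣≡1+∣p∣ zero    (inside  ∷ p) x∉p = contradiction here x∉p
x∉p⇒∣⁅x⁆∪p∣≡1+∣p∣ zero    (outside ∷ p) x∉p = cong (suc ∘ ∣_∣) (∪-identityˡ p)
x∉p⇒∣⁅x⁆∪p∣≡1+∣p∣ (suc x) (inside  ∷ p) x∉p = cong suc (x∉p⇒∣⁅x⁆∪p∣≡1+∣p∣ x p (x∉p ∘ there))
x∉p⇒∣⁅x⁆∪p∣≡1+∣p∣ (suc x) (outside ∷ p) x∉p = x∉p⇒∣⁅x⁆∪p∣≡1+∣p∣ x p (x∉p ∘ there)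

∣p∪q∣≤∣p∣+∣q∣ : ∀ (p q : Subset n) → ∣ p ∪ q ∣ ≤ ∣ p ∣ + ∣ q ∣
∣p∪q∣≤∣p∣+∣q∣ []            []            = z≤n
∣p∪q∣≤∣p∣+∣q∣ (inside  ∷ p) (inside  ∷ q) =
  s≤s (≤-trans (∣p∪q∣≤∣p∣+∣q∣ p q) (+-monoʳ-≤ ∣ p ∣ (n≤1+n ∣ q ∣)))
∣p∪q∣≤∣p∣+∣q∣ (inside  ∷ p) (outside ∷ q) = s≤s (∣p∪q∣≤∣p∣+∣q∣ p q)
∣p∪q∣≤∣p∣+∣q∣ (outside ∷ p) (inside  ∷ q) =
  ≤-trans (s≤s (∣p∪q∣≤∣p∣+∣q∣ p q)) (≤-reflexive (sym (+-suc ∣ p ∣ ∣ q ∣)))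
∣p∪q∣≤∣p∣+∣q∣ (outside ∷ p) (outside ∷ q) = ∣p∪q∣≤∣p∣+∣q∣ p q

∣p++q∣≡∣p∣+∣q∣ : ∀ (p : Subset m) (q : Subset n) → ∣ p ++ᵛ q ∣ ≡ ∣ p ∣ + ∣ q ∣
∣p++q∣≡∣p∣+∣q∣ []            q = refl
∣p++q∣≡∣p∣+∣q∣ (inside  ∷ p) q = cong suc (∣p++q∣≡∣p∣+∣q∣ p q)
∣p++q∣≡∣p∣+∣q∣ (outside ∷ p) q = ∣p++q∣≡∣p∣+∣q∣ p q

∣p∣<∣q∣⇒∃∈q∖p : ∀ {p q : Subset n} → ∣ p ∣ < ∣ q ∣ → ∃ λ x → x ∈ q × x ∉ p
∣p∣<∣q∣⇒∃∈q∖p {p = p} {q} ∣p∣<∣q∣ with nonempty? (q ∩ ∁ p)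
... | yes (x , x∈q∩∁p) = let x∈q , x∈∁p = x∈p∩q⁻ q (∁ p) x∈q∩∁p in x , x∈q , x∈∁p⇒x∉p x∈∁p
... | no q∩∁p-empty = contradiction (p⊆q⇒∣p∣≤∣q∣ q⊆p) (<⇒≱ ∣p∣<∣q∣)
  where
  q⊆p : q ⊆ p
  q⊆p {x} x∈q with x ∈? p
  ... | yes x∈p = x∈p
  ... | no  x∉p = contradiction (x , x∈p∩q⁺ (x∈q , x∉p⇒x∈∁p x∉p)) q∩∁p-empty

p⊆q∧∣q∣≤∣p∣⇒p≡q : ∀ {p q : Subset n} → p ⊆ q → ∣ q ∣ ≤ ∣ p ∣ → p ≡ q
p⊆q∧∣q∣≤∣p∣⇒p≡q {p = p} p⊆q ∣q∣≤∣p∣ = ⊆-antisym p⊆q q⊆p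
  where
  q⊆p : _ ⊆ p
  q⊆p {x} x∈q with x ∈? p
  ... | yes x∈p = x∈p
  ... | no  x∉p = contradiction (p⊂q⇒∣p∣<∣q∣ (p⊆q , x , x∈q , x∉p)) (≤⇒≯ ∣q∣≤∣p∣)

image : (Fin m → Fin n) → Subset n
image {zero}  f = ⊥
image {suc m} f = ⁅ f zero ⁆ ∪ image (f ∘ suc)

∈-image⁻ : ∀ (f : Fin m → Fin n) {y} → y ∈ image f → ∃ λ x → f x ≡ y
∈-image⁻ {zero}  f y∈ = contradiction y∈ ∉⊥
∈-image⁻ {suc m} f y∈ with x∈p∪q⁻ ⁅ f zero ⁆ (image (f ∘ suc)) y∈
... | inj₁ y∈⁅f0⁆ = zero , sym (x∈⁅y⁆⇒x≡y (f zero) y∈⁅f0⁆)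
... | inj₂ y∈rest with ∈-image⁻ (f ∘ suc) y∈rest
...   | x , fx≡y = suc x , fx≡y

injective⇒∣image∣≡m : ∀ (f : Fin m → Fin n) → Injective _≡_ _≡_ f → ∣ image f ∣ ≡ m
injective⇒∣image∣≡m {zero}  {n} f f-inj = ∣⊥∣≡0 n
injective⇒∣image∣≡m {suc m} f f-inj = begin
  ∣ ⁅ f zero ⁆ ∪ image (f ∘ suc) ∣ ≡⟨ x∉p⇒∣⁅x⁆∪p∣≡1+∣p∣ (f zero) _ f0∉rest ⟩
  suc ∣ image (f ∘ suc) ∣          ≡⟨ cong suc (injective⇒∣image∣≡m (f ∘ suc) (suc-injective ∘ f-inj)) ⟩
  suc m                            ∎
  where
  open ≡-Reasoning
  f0∉rest : f zero ∉ image (f ∘ suc)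
  f0∉rest f0∈ with ∈-image⁻ (f ∘ suc) f0∈
  ... | x , fsx≡f0 with f-inj fsx≡f0
  ...   | ()

module _ {A : Set} where

  Unique⇒lookup-injective : ∀ {xs : List A} → Unique xs → Injective _≡_ _≡_ (lookup xs)
  Unique⇒lookup-injective               (x∉xs ∷ u) {zero}  {zero}  _  = refl
  Unique⇒lookup-injective {xs = _ ∷ xs} (x∉xs ∷ u) {zero}  {suc j} eq =
    contradiction eq (All.lookup x∉xs (∈-lookup {xs = xs} j))
  Unique⇒lookup-injective {xs = _ ∷ xs} (x∉xs ∷ u) {suc i} {zero}  eq =
    contradiction (sym eq) (All.lookup x∉xs (∈-lookup {xs = xs} i))
  Unique⇒lookup-injective               (x∉xs ∷ u) {suc i} {suc j} eq =
    cong suc (Unique⇒lookup-injective u eq)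

  Unique∧⊆⇒length≤ : ∀ {xs ys : List A} → Unique xs → xs ⊆ₗ ys → length xs ≤ length ys
  Unique∧⊆⇒length≤ {xs} {ys} u xs⊆ys = injective⇒≤ position-injective
    where
    position : Fin (length xs) → Fin (length ys)
    position i = Any.index (xs⊆ys (∈-lookup i))
    position-injective : Injective _≡_ _≡_ position
    position-injective {i} {j} eq = Unique⇒lookup-injective u (begin
      lookup xs i            ≡⟨ lookup-index (xs⊆ys (∈-lookup i)) ⟩
      lookup ys (position i) ≡⟨ cong (lookup ys) eq ⟩
      lookup ys (position j) ≡⟨ lookup-index (xs⊆ys (∈-lookup j)) ⟨
      lookup xs j            ∎)
      where open ≡-Reasoning

  module _ {P : Pred A 0ℓ} (P? : Decidable P) where

    length-filter+length-filter∁ : ∀ xs →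
      length (filter P? xs) + length (filter (∁? P?) xs) ≡ length xs
    length-filter+length-filter∁ []       = refl
    length-filter+length-filter∁ (x ∷ xs) with P? x
    ... | yes _ = cong suc (length-filter+length-filter∁ xs)
    ... | no  _ = trans (+-suc _ _) (cong suc (length-filter+length-filter∁ xs))

    ∃∈-filter : ∀ xs → 1 ≤ length (filter P? xs) → ∃ λ x → x ∈ₗ xs × P x
    ∃∈-filter xs 1≤ with filter P? xs in eq
    ... | x ∷ _ = x , ∈-filter⁻ P? (subst (x ∈ₗ_) (sym eq) (Any.here refl))

  length≤length+length-filter∉ : ∀ {xs ys : List A} (∈ys? : Decidable (_∈ₗ ys)) → Unique xs →
    length xs ≤ length ys + length (filter (∁? ∈ys?) xs)
  length≤length+length-filter∉ {xs} {ys} ∈ys? u = begin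
    length xs                                              ≡⟨ length-filter+length-filter∁ ∈ys? xs ⟨
    length (filter ∈ys? xs) + length (filter (∁? ∈ys?) xs) ≤⟨ +-monoˡ-≤ _ filtered≤ ⟩
    length ys + length (filter (∁? ∈ys?) xs)               ∎
    where
    open ≤-Reasoning
    filtered≤ : length (filter ∈ys? xs) ≤ length ys
    filtered≤ = Unique∧⊆⇒length≤ (Unique.filter⁺ ∈ys? u) (proj₂ ∘ ∈-filter⁻ ∈ys? {xs = xs})

subsetsOfSize : (n k : ℕ) → List (Subset n)
subsetsOfSize zero    zero    = [] ∷ []
subsetsOfSize zero    (suc k) = []
subsetsOfSize (suc n) zero    = map (outside ∷_) (subsetsOfSize n zero)
subsetsOfSize (suc n) (suc k) =
  map (inside ∷_) (subsetsOfSize n k) ++ map (outside ∷_) (subsetsOfSize n (suc k))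

length-subsetsOfSize : (n k : ℕ) → length (subsetsOfSize n k) ≡ n C k
length-subsetsOfSize zero    zero    = refl
length-subsetsOfSize zero    (suc k) = refl
length-subsetsOfSize (suc n) zero    =
  trans (length-map _ (subsetsOfSize n zero)) (length-subsetsOfSize n zero)
length-subsetsOfSize (suc n) (suc k) = begin
  length (map (inside ∷_) (subsetsOfSize n k) ++ map (outside ∷_) (subsetsOfSize n (suc k)))
    ≡⟨ length-++ (map (inside ∷_) (subsetsOfSize n k)) ⟩
  length (map (inside ∷_) (subsetsOfSize n k)) + length (map (outside ∷_) (subsetsOfSize n (suc k)))
    ≡⟨ cong₂ _+_ (length-map _ (subsetsOfSize n k)) (length-map _ (subsetsOfSize n (suc k))) ⟩
  length (subsetsOfSize n k) + length (subsetsOfSize n (suc k))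
    ≡⟨ cong₂ _+_ (length-subsetsOfSize n k) (length-subsetsOfSize n (suc k)) ⟩
  n C k + n C suc k
    ≡⟨ nCk+nC[k+1]≡[n+1]C[k+1] n k ⟩
  suc n C suc k ∎
  where open ≡-Reasoning

∣∣≡k-subsetsOfSize : (n k : ℕ) → All (λ p → ∣ p ∣ ≡ k) (subsetsOfSize n k)
∣∣≡k-subsetsOfSize zero    zero    = refl ∷ []
∣∣≡k-subsetsOfSize zero    (suc k) = []
∣∣≡k-subsetsOfSize (suc n) zero    = All.map⁺ {f = outside ∷_} (∣∣≡k-subsetsOfSize n zero)
∣∣≡k-subsetsOfSize (suc n) (suc k) =
  All.++⁺ (All.map⁺ {f = inside ∷_} (All.map (cong suc) (∣∣≡k-subsetsOfSize n k)))
          (All.map⁺ {f = outside ∷_} (∣∣≡k-subsetsOfSize n (suc k)))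

Unique-subsetsOfSize : (n k : ℕ) → Unique (subsetsOfSize n k)
Unique-subsetsOfSize zero    zero    = [] ∷ []
Unique-subsetsOfSize zero    (suc k) = []
Unique-subsetsOfSize (suc n) zero    = Unique.map⁺ ∷-injectiveʳ (Unique-subsetsOfSize n zero)
Unique-subsetsOfSize (suc n) (suc k) =
  Unique.++⁺ (Unique.map⁺ ∷-injectiveʳ (Unique-subsetsOfSize n k))
             (Unique.map⁺ ∷-injectiveʳ (Unique-subsetsOfSize n (suc k)))
             heads-differ
  where
  heads-differ : ∀ {p} → ¬ (p ∈ₗ map (inside ∷_) (subsetsOfSize n k) ×
                             p ∈ₗ map (outside ∷_) (subsetsOfSize n (suc k)))
  heads-differ (p∈ᵢ , p∈ₒ) with ∈-map⁻ (inside ∷_) p∈ᵢ | ∈-map⁻ (outside ∷_) p∈ₒ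
  ... | _ , _ , refl | _ , _ , ()

-- ContainsStarTrace without the requirement that the host edges be distinct,
-- so that having no such trace is the stronger property.
record StarTrace {n : ℕ} (t : ℕ) (E : List (Subset n)) : Set where
  field
    vertex           : Fin (suc t) → Fin n
    edge             : Fin t → Subset n
    vertex-injective : Injective _≡_ _≡_ vertex
    edge∈            : ∀ i → edge i ∈ₗ E
    trace            : ∀ i j → vertex j ∈ edge i ⇔ (j ≡ zero ⊎ j ≡ suc i)

  leaves : Subset n
  leaves = image (vertex ∘ suc)

  ∣leaves∣≡t : ∣ leaves ∣ ≡ t
  ∣leaves∣≡t = injective⇒∣image∣≡m (vertex ∘ suc) (suc-injective ∘ vertex-injective)

  ∣∁leaves∣≡n∸t : ∣ ∁ leaves ∣ ≡ n ∸ t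
  ∣∁leaves∣≡n∸t = trans (∣∁p∣≡n∸∣p∣ leaves) (cong (n ∸_) ∣leaves∣≡t)

  centre∈ : ∀ i → vertex zero ∈ edge i
  centre∈ i = Equivalence.from (trace i zero) (inj₁ refl)

  edge⊆leaf∪∁leaves : ∀ i → edge i ⊆ ⁅ vertex (suc i) ⁆ ∪ ∁ leaves
  edge⊆leaf∪∁leaves i {y} y∈edge with y ∈? leaves
  ... | no  y∉leaves = x∈p∪q⁺ (inj₂ (x∉p⇒x∈∁p y∉leaves))
  ... | yes y∈leaves with ∈-image⁻ (vertex ∘ suc) y∈leaves
  ...   | j , refl with Equivalence.to (trace i (suc j)) y∈edge
  ...     | inj₂ refl = x∈p∪q⁺ (inj₁ (x∈⁅x⁆ _))

  ∣∁leaves∣<∣K∣⇒∃leaf∈K : ∀ {K} → ∣ ∁ leaves ∣ < ∣ K ∣ → ∃ λ i → vertex (suc i) ∈ K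
  ∣∁leaves∣<∣K∣⇒∃leaf∈K ∣∁leaves∣<∣K∣ with ∣p∣<∣q∣⇒∃∈q∖p ∣∁leaves∣<∣K∣
  ... | x , x∈K , x∉∁leaves with ∈-image⁻ (vertex ∘ suc) (x∉∁p⇒x∈p x∉∁leaves)
  ...   | i , refl = i , x∈K

  leaf∪∁leaves⊆K⇒edge≡K : ∀ i {K} → vertex (suc i) ∈ K → ∁ leaves ⊆ K → ∣ K ∣ ≤ ∣ edge i ∣ → edge i ≡ K
  leaf∪∁leaves⊆K⇒edge≡K i {K} leaf∈K ∁leaves⊆K ∣K∣≤∣edge∣ = p⊆q∧∣q∣≤∣p∣⇒p≡q edge⊆K ∣K∣≤∣edge∣
    where
    edge⊆K : edge i ⊆ K
    edge⊆K y∈edge with x∈p∪q⁻ ⁅ vertex (suc i) ⁆ (∁ leaves) (edge⊆leaf∪∁leaves i y∈edge)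
    ... | inj₁ y∈⁅leaf⁆  = subst (_∈ K) (sym (x∈⁅y⁆⇒x≡y _ y∈⁅leaf⁆)) leaf∈K
    ... | inj₂ y∈∁leaves = ∁leaves⊆K y∈∁leaves

ContainsStarTrace⇒StarTrace : ∀ {H : UniformHypergraph r n} →
  ContainsStarTrace t H → StarTrace t (edges H)
ContainsStarTrace⇒StarTrace {H = H} (w , f , w-injective , _ , trace) = record
  { vertex           = w
  ; edge             = lookup (edges H) ∘ f
  ; vertex-injective = w-injective
  ; edge∈            = ∈-lookup ∘ f
  ; trace            = trace
  }

StarTrace⇒r+t≤n : ∀ {E : List (Subset n)} → All (λ e → ∣ e ∣ ≡ r) E → StarTrace (suc t) E → r + t ≤ n
StarTrace⇒r+t≤n {n} {r} {t} E-uniform s = begin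
  r + t                   ≡⟨ cong (_+ t) (All.lookup E-uniform (edge∈ zero)) ⟨
  ∣ edge zero ∣ + t       ≤⟨ +-monoˡ-≤ t ∣edge₀∣≤ ⟩
  suc (n ∸ suc t) + t     ≡⟨ +-suc (n ∸ suc t) t ⟨
  n ∸ suc t + suc t       ≡⟨ m∸n+n≡m (subst (_≤ n) ∣leaves∣≡t (∣p∣≤n leaves)) ⟩
  n                       ∎
  where
  open StarTrace s
  open ≤-Reasoning
  ∣edge₀∣≤ : ∣ edge zero ∣ ≤ suc (n ∸ suc t)
  ∣edge₀∣≤ = begin
    ∣ edge zero ∣                            ≤⟨ p⊆q⇒∣p∣≤∣q∣ (edge⊆leaf∪∁leaves zero) ⟩
    ∣ ⁅ vertex (suc zero) ⁆ ∪ ∁ leaves ∣     ≤⟨ ∣p∪q∣≤∣p∣+∣q∣ ⁅ vertex (suc zero) ⁆ (∁ leaves) ⟩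
    ∣ ⁅ vertex (suc zero) ⁆ ∣ + ∣ ∁ leaves ∣ ≡⟨ cong₂ _+_ (∣⁅x⁆∣≡1 (vertex (suc zero))) ∣∁leaves∣≡n∸t ⟩
    suc (n ∸ suc t)                          ∎

IsCovering∧avoiding⇒¬StarTrace : ∀ {𝒞 E : List (Subset (suc r + t))} →
  IsCovering (suc r) (suc r + t) (suc (suc r)) 1 𝒞 →
  All (λ e → ∣ e ∣ ≡ suc (suc r)) E → All (_∉ₗ 𝒞) E → ¬ StarTrace t E
IsCovering∧avoiding⇒¬StarTrace {r} {t} {𝒞} (blocks-sized , covers) E-uniform E-avoids s =
  let K , K∈𝒞 , ∁leaves⊆K = ∃∈-filter (∁ leaves ⊆?_) 𝒞 (covers (∁ leaves) ∣∁leaves∣≡1+r)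
      ∣K∣≡2+r            = All.lookup blocks-sized K∈𝒞
      i , leaf∈K         = ∣∁leaves∣<∣K∣⇒∃leaf∈K (subst₂ _<_ (sym ∣∁leaves∣≡1+r) (sym ∣K∣≡2+r) ≤-refl)
      ∣K∣≤∣edge∣         = ≤-reflexive (trans ∣K∣≡2+r (sym (All.lookup E-uniform (edge∈ i))))
      edge≡K             = leaf∪∁leaves⊆K⇒edge≡K i leaf∈K ∁leaves⊆K ∣K∣≤∣edge∣
  in  All.lookup E-avoids (edge∈ i) (subst (_∈ₗ 𝒞) (sym edge≡K) K∈𝒞)
  where
  open StarTrace s
  ∣∁leaves∣≡1+r : ∣ ∁ leaves ∣ ≡ suc r
  ∣∁leaves∣≡1+r = trans ∣∁leaves∣≡n∸t (m+n∸n≡m (suc r) t)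

↑ˡ∈++⁺ : ∀ {x : Fin m} {p : Subset m} {q : Subset n} → x ∈ p → x ↑ˡ n ∈ p ++ᵛ q
↑ˡ∈++⁺ here      = here
↑ˡ∈++⁺ (there h) = there (↑ˡ∈++⁺ h)

↑ˡ∈++⁻ : ∀ {x : Fin m} {p : Subset m} {q : Subset n} → x ↑ˡ n ∈ p ++ᵛ q → x ∈ p
↑ˡ∈++⁻ {x = zero}  {p = _ ∷ _} here      = here
↑ˡ∈++⁻ {x = suc x} {p = _ ∷ _} (there h) = there (↑ˡ∈++⁻ h)

↑ʳ∈++⁺ : ∀ {y : Fin n} {p : Subset m} {q : Subset n} → y ∈ q → m ↑ʳ y ∈ p ++ᵛ q
↑ʳ∈++⁺ {p = []}    h = h
↑ʳ∈++⁺ {p = _ ∷ p} h = there (↑ʳ∈++⁺ {p = p} h)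

↑ʳ∈++⁻ : ∀ {y : Fin n} {p : Subset m} {q : Subset n} → m ↑ʳ y ∈ p ++ᵛ q → y ∈ q
↑ʳ∈++⁻ {p = []}    h         = h
↑ʳ∈++⁻ {p = _ ∷ p} (there h) = ↑ʳ∈++⁻ {p = p} h

↑ˡ-or-↑ʳ : ∀ m {n} (y : Fin (m + n)) → (∃ λ x → x ↑ˡ n ≡ y) ⊎ (∃ λ x → m ↑ʳ x ≡ y)
↑ˡ-or-↑ʳ m y with splitAt m y in eq
... | inj₁ x = inj₁ (x , splitAt⁻¹-↑ˡ eq)
... | inj₂ x = inj₂ (x , splitAt⁻¹-↑ʳ eq)

embedˡ : ∀ n → Subset m → Subset (m + n)
embedˡ n p = p ++ᵛ ⊥

embedʳ : ∀ m → Subset n → Subset (m + n)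
embedʳ m q = ⊥ ++ᵛ q

embedˡ⊆image : ∀ {m} n (p : Subset m) {y} → y ∈ embedˡ n p → ∃ λ x → x ↑ˡ n ≡ y
embedˡ⊆image {m} n p {y} y∈ with ↑ˡ-or-↑ʳ m y
... | inj₁ preimage = preimage
... | inj₂ (x , refl) = contradiction (↑ʳ∈++⁻ {p = p} y∈) ∉⊥

embedʳ⊆image : ∀ m {n} (q : Subset n) {y} → y ∈ embedʳ m q → ∃ λ x → m ↑ʳ x ≡ y
embedʳ⊆image m q {y} y∈ with ↑ˡ-or-↑ʳ m y
... | inj₁ (x , refl) = contradiction (↑ˡ∈++⁻ y∈) ∉⊥
... | inj₂ preimage = preimage

embedˡ-embedʳ-disjoint : ∀ (p : Subset m) (q : Subset n) {x} → x ∈ embedˡ n p → x ∉ embedʳ m q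
embedˡ-embedʳ-disjoint {m} p q {x} x∈ˡ x∈ʳ with ↑ˡ-or-↑ʳ m x
... | inj₁ (y , refl) = ∉⊥ (↑ˡ∈++⁻ x∈ʳ)
... | inj₂ (y , refl) = ∉⊥ (↑ʳ∈++⁻ {p = p} x∈ˡ)

module _ {g : Fin m → Fin n} (g-injective : Injective _≡_ _≡_ g) {lift : Subset m → Subset n}
         (∈-lift : ∀ x p → g x ∈ lift p ⇔ x ∈ p)
         (lift⊆image : ∀ p {y} → y ∈ lift p → ∃ λ x → g x ≡ y) where

  StarTrace-map⁻ : ∀ {E} → StarTrace (suc t) (map lift E) → StarTrace (suc t) E
  StarTrace-map⁻ {t} {E} s = record
    { vertex           = proj₁ ∘ vertex-preimage
    ; edge             = proj₁ ∘ edge-preimage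
    ; vertex-injective = λ {j} {k} eq → vertex-injective (begin
        vertex j                      ≡⟨ proj₂ (vertex-preimage j) ⟨
        g (proj₁ (vertex-preimage j)) ≡⟨ cong g eq ⟩
        g (proj₁ (vertex-preimage k)) ≡⟨ proj₂ (vertex-preimage k) ⟩
        vertex k                      ∎)
    ; edge∈            = proj₁ ∘ proj₂ ∘ edge-preimage
    ; trace            = λ i j → ⇔.trans (⇔.sym (∈-lift _ _))
        (subst₂ (λ y e → y ∈ e ⇔ _) (sym (proj₂ (vertex-preimage j)))
                (proj₂ (proj₂ (edge-preimage i))) (trace i j))
    }
    where
    open StarTrace s
    open ≡-Reasoning
    edge-preimage : ∀ i → ∃ λ p → p ∈ₗ E × edge i ≡ lift p
    edge-preimage i = ∈-map⁻ lift (edge∈ i)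
    -- The centre lies on an edge only because there is at least one (t + 1 > 0).
    some-edge∋ : ∀ j → ∃ λ i → vertex j ∈ edge i
    some-edge∋ zero    = zero , centre∈ zero
    some-edge∋ (suc i) = i , Equivalence.from (trace i (suc i)) (inj₂ refl)
    vertex-preimage : ∀ j → ∃ λ x → g x ≡ vertex j
    vertex-preimage j with some-edge∋ j
    ... | i , vⱼ∈eᵢ = lift⊆image _ (subst (vertex j ∈_) (proj₂ (proj₂ (edge-preimage i))) vⱼ∈eᵢ)

StarTrace-with-edges∈ : ∀ {E F : List (Subset n)} (s : StarTrace t E) →
  (∀ i → StarTrace.edge s i ∈ₗ F) → StarTrace t F
StarTrace-with-edges∈ s edge∈F = record { StarTrace s hiding (edge∈) ; edge∈ = edge∈F }

StarTrace-++⁻ : ∀ {E₁ E₂ : List (Subset n)} →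
  (∀ {e₁ e₂ x} → e₁ ∈ₗ E₁ → e₂ ∈ₗ E₂ → x ∈ e₁ → x ∉ e₂) →
  StarTrace (suc t) (E₁ ++ E₂) → StarTrace (suc t) E₁ ⊎ StarTrace (suc t) E₂
StarTrace-++⁻ {E₁ = E₁} disjoint s with ∈-++⁻ E₁ (edge∈ zero)
  where open StarTrace s
... | inj₁ e₀∈E₁ = inj₁ (StarTrace-with-edges∈ s on-side₁)
  where
  open StarTrace s
  on-side₁ : ∀ i → edge i ∈ₗ E₁
  on-side₁ i with ∈-++⁻ E₁ (edge∈ i)
  ... | inj₁ eᵢ∈E₁ = eᵢ∈E₁
  ... | inj₂ eᵢ∈E₂ = ⊥-elim (disjoint e₀∈E₁ eᵢ∈E₂ (centre∈ zero) (centre∈ i))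
... | inj₂ e₀∈E₂ = inj₂ (StarTrace-with-edges∈ s on-side₂)
  where
  open StarTrace s
  on-side₂ : ∀ i → edge i ∈ₗ _
  on-side₂ i with ∈-++⁻ E₁ (edge∈ i)
  ... | inj₁ eᵢ∈E₁ = ⊥-elim (disjoint eᵢ∈E₁ e₀∈E₂ (centre∈ i) (centre∈ zero))
  ... | inj₂ eᵢ∈E₂ = eᵢ∈E₂

_⊕_ : UniformHypergraph (suc r) m → UniformHypergraph (suc r) n → UniformHypergraph (suc r) (m + n)
_⊕_ {r} {m} {n} H₁ H₂ = record
  { edges    = map (embedˡ n) (edges H₁) ++ map (embedʳ m) (edges H₂)
  ; distinct = Unique.++⁺ (Unique.map⁺ (++-injectiveˡ _ _) (distinct H₁))
                          (Unique.map⁺ (++-injectiveʳ ⊥ ⊥) (distinct H₂))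
                          no-common-edge
  ; uniform  = All.++⁺ (All.map⁺ (All.map (λ {p} → trans (∣embedˡ∣ p)) (uniform H₁)))
                       (All.map⁺ (All.map (λ {q} → trans (∣embedʳ∣ q)) (uniform H₂)))
  }
  where
  ∣embedˡ∣ : ∀ p → ∣ embedˡ n p ∣ ≡ ∣ p ∣
  ∣embedˡ∣ p = trans (∣p++q∣≡∣p∣+∣q∣ p ⊥) (trans (cong (∣ p ∣ +_) (∣⊥∣≡0 n)) (+-identityʳ ∣ p ∣))
  ∣embedʳ∣ : ∀ q → ∣ embedʳ m q ∣ ≡ ∣ q ∣
  ∣embedʳ∣ q = trans (∣p++q∣≡∣p∣+∣q∣ (⊥ {m}) q) (cong (_+ ∣ q ∣) (∣⊥∣≡0 m))
  -- A common edge p ++ ⊥ = ⊥ ++ q would force p = ⊥, but edges are nonempty.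
  no-common-edge : ∀ {e} → ¬ (e ∈ₗ map (embedˡ n) (edges H₁) × e ∈ₗ map (embedʳ m) (edges H₂))
  no-common-edge (e∈₁ , e∈₂) with ∈-map⁻ (embedˡ n) e∈₁ | ∈-map⁻ (embedʳ m) e∈₂
  ... | p , p∈ , refl | q , _ , eq =
    0≢1+n (trans (sym (trans (cong ∣_∣ (++-injectiveˡ p ⊥ eq)) (∣⊥∣≡0 m)))
                 (All.lookup (uniform H₁) p∈))

numEdges-⊕ : ∀ (H₁ : UniformHypergraph (suc r) m) (H₂ : UniformHypergraph (suc r) n) →
  numEdges (H₁ ⊕ H₂) ≡ numEdges H₁ + numEdges H₂
numEdges-⊕ {m = m} {n} H₁ H₂ =
  trans (length-++ (map (embedˡ n) (edges H₁)))
        (cong₂ _+_ (length-map _ (edges H₁)) (length-map _ (edges H₂)))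

⊕-¬StarTrace : ∀ {H₁ : UniformHypergraph (suc r) m} {H₂ : UniformHypergraph (suc r) n} →
  ¬ StarTrace (suc t) (edges H₁) → ¬ StarTrace (suc t) (edges H₂) →
  ¬ StarTrace (suc t) (edges (H₁ ⊕ H₂))
⊕-¬StarTrace {m = m} {n} free₁ free₂ s with StarTrace-++⁻ sides-disjoint s
  where
  sides-disjoint : ∀ {e₁ e₂ x} → e₁ ∈ₗ map (embedˡ n) _ → e₂ ∈ₗ map (embedʳ m) _ → x ∈ e₁ → x ∉ e₂
  sides-disjoint e₁∈ e₂∈ with ∈-map⁻ (embedˡ n) e₁∈ | ∈-map⁻ (embedʳ m) e₂∈
  ... | p , _ , refl | q , _ , refl = embedˡ-embedʳ-disjoint p q
... | inj₁ s₁ = free₁ (StarTrace-map⁻ (↑ˡ-injective n _ _)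
                         (λ x p → mk⇔ ↑ˡ∈++⁻ ↑ˡ∈++⁺) (embedˡ⊆image n) s₁)
... | inj₂ s₂ = free₂ (StarTrace-map⁻ (↑ʳ-injective m _ _)
                         (λ x p → mk⇔ (↑ʳ∈++⁻ {p = ⊥}) ↑ʳ∈++⁺) (embedʳ⊆image m) s₂)

ExWitness : (r t m k : ℕ) → Set
ExWitness r t m k = Σ (UniformHypergraph r m) λ H → ¬ StarTrace t (edges H) × k ≤ numEdges H

ExWitness-+ : ∀ {m₁ m₂ k₁ k₂} → ExWitness (suc r) (suc t) m₁ k₁ → ExWitness (suc r) (suc t) m₂ k₂ →
  ExWitness (suc r) (suc t) (m₁ + m₂) (k₁ + k₂)
ExWitness-+ (H₁ , free₁ , k₁≤) (H₂ , free₂ , k₂≤) =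
  H₁ ⊕ H₂ , ⊕-¬StarTrace {H₁ = H₁} {H₂} free₁ free₂
  , subst (_ ≤_) (sym (numEdges-⊕ H₁ H₂)) (+-mono-≤ k₁≤ k₂≤)

ExWitness-*+ : ∀ {m₁ m₂ k₁ k₂} a → ExWitness (suc r) (suc t) m₁ k₁ → ExWitness (suc r) (suc t) m₂ k₂ →
  ExWitness (suc r) (suc t) (a * m₁ + m₂) (a * k₁ + k₂)
ExWitness-*+ zero    _  w₂ = w₂
ExWitness-*+ {m₁ = m₁} {m₂} {k₁} {k₂} (suc a) w₁ w₂ =
  subst₂ (ExWitness _ _) (sym (+-assoc m₁ (a * m₁) m₂)) (sym (+-assoc k₁ (a * k₁) k₂))
    (ExWitness-+ w₁ (ExWitness-*+ a w₁ w₂))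

ExWitness-complete : ∀ b → b < r + t → ExWitness r (suc t) b (b C r)
ExWitness-complete {r} b b<r+t =
  record { edges    = subsetsOfSize b r
         ; distinct = Unique-subsetsOfSize b r
         ; uniform  = ∣∣≡k-subsetsOfSize b r }
  , (λ s → <⇒≱ b<r+t (StarTrace⇒r+t≤n (∣∣≡k-subsetsOfSize b r) s))
  , ≤-reflexive (sym (length-subsetsOfSize b r))

_∈ₗ?_ : ∀ (p : Subset n) ps → Dec (p ∈ₗ ps)
p ∈ₗ? ps = Any.any? (≡-dec _≟ᵇ_ p) ps

ExWitness-coveringComplement : ∀ {𝒞 : List (Subset (suc r + t))} →
  IsCovering (suc r) (suc r + t) (suc (suc r)) 1 𝒞 →
  ExWitness (suc (suc r)) t (suc r + t) ((suc r + t) C suc (suc r) ∸ length 𝒞)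
ExWitness-coveringComplement {r} {t} {𝒞} covering =
  record { edges    = avoiding
         ; distinct = Unique.filter⁺ ∉𝒞? (Unique-subsetsOfSize v k)
         ; uniform  = avoiding-uniform }
  , IsCovering∧avoiding⇒¬StarTrace covering avoiding-uniform (All.all-filter ∉𝒞? (subsetsOfSize v k))
  , m≤n+o⇒m∸n≤o (v C k) (length 𝒞) count
  where
  v = suc r + t
  k = suc (suc r)
  ∉𝒞? = ∁? (_∈ₗ? 𝒞)
  avoiding = filter ∉𝒞? (subsetsOfSize v k)
  avoiding-uniform : All (λ e → ∣ e ∣ ≡ k) avoiding
  avoiding-uniform = All.filter⁺ ∉𝒞? (∣∣≡k-subsetsOfSize v k)
  count : v C k ≤ length 𝒞 + length avoiding
  count = subst (_≤ length 𝒞 + length avoiding) (length-subsetsOfSize v k)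
            (length≤length+length-filter∉ (_∈ₗ? 𝒞) (Unique-subsetsOfSize v k))

mainTheorem1 : (r t c a b n : ℕ) → 2 ≤ r → 2 ≤ t →
    IsMinCoveringSize (r ∸ 1) (r + t ∸ 1) r 1 c →
    n ≡ a * (r + t ∸ 1) + b → b ≤ r + t ∸ 2 →
    Σ (UniformHypergraph r n) λ H → ¬ ContainsStarTrace t H ×
      a * ((r + t ∸ 1) C r ∸ c) + b C r ≤ numEdges H
mainTheorem1 (suc (suc r)) (suc (suc t)) _ a b _ (s≤s (s≤s _)) (s≤s (s≤s _))
  ((𝒞 , covering , refl) , _) refl b≤r+t =
  let H , free , count =
        ExWitness-*+ a (ExWitness-coveringComplement covering) (ExWitness-complete b b<r+t)
  in  H , free ∘ ContainsStarTrace⇒StarTrace {H = H} , count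
  where
  b<r+t : b < suc (suc r) + suc t
  b<r+t = s≤s (≤-trans b≤r+t (≤-reflexive (+-suc r (suc t))))
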